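{- Let $f:\mathbb{Z}\to\mathbb{Z}$ satisfy: (1) $\mathrm{Sg}(n)f(n)\ge 0$ for all $n\in\mathbb{Z}$; and (2) for every integer $k\ge1$, $\sum_{n=-k}^{k-1}f(n)\le 0$ and $\sum_{n=-k}^{k}f(n)\ge 0$. Then $\mathrm{Sg}(a+b)\sum_{n=a}^{b}f(n)\ge 0$ for all $a,b\in\mathbb{Z}$.
   Context: $\mathrm{Sg}(x)=1$ if $x\ge 0$ and $\mathrm{Sg}(x)=-1$ if $x<0$. An empty sum (when $a>b$) is $0$. -}

module Defs where

open import Data.Nat using (ℕ; zero; suc)
open import Data.Integer using (ℤ; +_; _+_; _-_; _*_; _≤_; _<?_; 0ℤ; 1ℤ; -1ℤ; ∣_∣)
open import Relation.Nullary using (yes; no)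

Sg : ℤ → ℤ
Sg x with x <? 0ℤ
... | yes _ = -1ℤ
... | no  _ = 1ℤ

sumFrom : (ℤ → ℤ) → ℤ → ℕ → ℤ
sumFrom f a zero    = 0ℤ
sumFrom f a (suc m) = f a + sumFrom f (a + 1ℤ) m

sumRange : (ℤ → ℤ) → ℤ → ℤ → ℤ
sumRange f a b with b <? a
... | yes _ = 0ℤ
... | no  _ = sumFrom f a ∣ (b - a) + 1ℤ ∣

-- Write the sum over [a, b] as the sum S m of the m = b - a + 1 consecutive terms
-- starting at a. For a ≥ 0 all terms are nonnegative. For a = -(k+1), S decreases
-- while the terms are negative (m ≤ k + 1) and increases afterwards, so for m ≤ 2k + 2,
-- that is a + b < 0, S m ≤ max (0, S (2k + 2)) ≤ 0, and otherwise S m ≥ S (2k + 3) ≥ 0.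
module Submission where

open import Defs
open import Data.Nat using (ℕ; suc)
open import Data.Integer
  using (ℤ; +_; -_; _*_; _≤_; 0ℤ; _+_; -[1+_]; _-_; _<_; _<?_; 1ℤ; -1ℤ; _⊖_; ∣_∣; +≤+)
open import Data.Integer.Properties
open import Data.Integer.Tactic.RingSolver using (solve-∀)
import Data.Nat as ℕ
import Data.Nat.Properties as ℕ
open import Data.Product using (∃-syntax; _,_)
open import Data.Sum using (_⊎_; inj₁; inj₂)
open import Relation.Binary.PropositionalEquality
open import Relation.Nullary using (yes; no)
open import Relation.Nullary.Negation using (contradiction)

Sg-nonneg : ∀ {x} → 0ℤ ≤ x → Sg x ≡ 1ℤ
Sg-nonneg {x} 0≤x with x <? 0ℤ
... | yes x<0 = contradiction x<0 (≤⇒≯ 0≤x)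
... | no  _   = refl

Sg-neg : ∀ {x} → x < 0ℤ → Sg x ≡ -1ℤ
Sg-neg {x} x<0 with x <? 0ℤ
... | yes _   = refl
... | no  x≮0 = contradiction x<0 x≮0

Sg*-nonneg : ∀ {s} → 0ℤ ≤ s → ∀ x → Sg s * x ≡ x
Sg*-nonneg 0≤s x = trans (cong (_* x) (Sg-nonneg 0≤s)) (*-identityˡ x)

Sg*-neg : ∀ {s} → s < 0ℤ → ∀ x → Sg s * x ≡ - x
Sg*-neg s<0 x = trans (cong (_* x) (Sg-neg s<0)) (-1*i≡-i x)

0≤Sg*-nonneg : ∀ {s x} → 0ℤ ≤ s → 0ℤ ≤ x → 0ℤ ≤ Sg s * x
0≤Sg*-nonneg {x = x} 0≤s 0≤x = subst (0ℤ ≤_) (sym (Sg*-nonneg 0≤s x)) 0≤x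

0≤Sg*-neg : ∀ {s x} → s < 0ℤ → x ≤ 0ℤ → 0ℤ ≤ Sg s * x
0≤Sg*-neg {x = x} s<0 x≤0 = subst (0ℤ ≤_) (sym (Sg*-neg s<0 x)) (neg-mono-≤ x≤0)

m<n⇒m⊖n<0 : ∀ {m n} → m ℕ.< n → m ⊖ n < 0ℤ
m<n⇒m⊖n<0 {m} {n} m<n = subst (m ⊖ n <_) (n⊖n≡0 n) (⊖-monoˡ-< n m<n)

n≤m⇒0≤m⊖n : ∀ {m n} → n ℕ.≤ m → 0ℤ ≤ m ⊖ n
n≤m⇒0≤m⊖n n≤m = subst (0ℤ ≤_) (sym (⊖-≥ n≤m)) (+≤+ ℕ.z≤n)

-[1+m]+[1+m+n]≡n : ∀ m n → -[1+ m ] + + (suc m ℕ.+ n) ≡ + n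
-[1+m]+[1+m+n]≡n m n = trans (⊖-≥ (ℕ.m≤m+n (suc m) n)) (cong +_ (ℕ.m+n∸m≡n (suc m) n))

i+[j-i]≡j : ∀ i j → i + (j - i) ≡ j
i+[j-i]≡j = solve-∀

<⊎≡+ : ∀ a b → b < a ⊎ ∃[ n ] b ≡ a + + n
<⊎≡+ a b with b <? a
... | yes b<a = inj₁ b<a
... | no  b≮a = inj₂ (∣ b - a ∣ , sym (begin
  a + + ∣ b - a ∣ ≡⟨ cong (λ c → a + c) (0≤i⇒+∣i∣≡i (i≤j⇒0≤j-i (≮⇒≥ b≮a))) ⟩
  a + (b - a)     ≡⟨ i+[j-i]≡j a b ⟩
  b               ∎))
  where open ≡-Reasoning

sumFrom-++ : ∀ f a m n → sumFrom f a (m ℕ.+ n) ≡ sumFrom f a m + sumFrom f (a + + m) n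
sumFrom-++ f a ℕ.zero n = begin
  sumFrom f a n              ≡⟨ cong (λ b → sumFrom f b n) (+-identityʳ a) ⟨
  sumFrom f (a + 0ℤ) n       ≡⟨ +-identityˡ _ ⟨
  0ℤ + sumFrom f (a + 0ℤ) n  ∎
  where open ≡-Reasoning
sumFrom-++ f a (suc m) n = begin
  f a + sumFrom f (a + 1ℤ) (m ℕ.+ n)
    ≡⟨ cong (λ s → f a + s) (sumFrom-++ f (a + 1ℤ) m n) ⟩
  f a + (sumFrom f (a + 1ℤ) m + sumFrom f (a + 1ℤ + + m) n)
    ≡⟨ +-assoc (f a) _ _ ⟨
  f a + sumFrom f (a + 1ℤ) m + sumFrom f (a + 1ℤ + + m) n
    ≡⟨ cong (λ b → f a + sumFrom f (a + 1ℤ) m + sumFrom f b n) (+-assoc a 1ℤ (+ m)) ⟩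
  f a + sumFrom f (a + 1ℤ) m + sumFrom f (a + + suc m) n
    ∎
  where open ≡-Reasoning

sumFrom-mono-≤ : ∀ {f g} a m → (∀ i → i ℕ.< m → f (a + + i) ≤ g (a + + i)) →
                 sumFrom f a m ≤ sumFrom g a m
sumFrom-mono-≤ a ℕ.zero    _   = ≤-refl
sumFrom-mono-≤ {f} {g} a (suc m) f≤g = +-mono-≤ head (sumFrom-mono-≤ (a + 1ℤ) m tail)
  where
  head : f a ≤ g a
  head = subst (λ b → f b ≤ g b) (+-identityʳ a) (f≤g 0 ℕ.z<s)
  tail : ∀ i → i ℕ.< m → f (a + 1ℤ + + i) ≤ g (a + 1ℤ + + i)
  tail i i<m = subst (λ b → f b ≤ g b) (sym (+-assoc a 1ℤ (+ i))) (f≤g (suc i) (ℕ.s<s i<m))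

sumFrom-zero : ∀ a m → sumFrom (λ _ → 0ℤ) a m ≡ 0ℤ
sumFrom-zero a ℕ.zero    = refl
sumFrom-zero a (suc m) = trans (+-identityˡ _) (sumFrom-zero (a + 1ℤ) m)

sumFrom-nonneg : ∀ f a m → (∀ i → i ℕ.< m → 0ℤ ≤ f (a + + i)) → 0ℤ ≤ sumFrom f a m
sumFrom-nonneg f a m 0≤f = subst (_≤ sumFrom f a m) (sumFrom-zero a m) (sumFrom-mono-≤ a m 0≤f)

sumFrom-nonpos : ∀ f a m → (∀ i → i ℕ.< m → f (a + + i) ≤ 0ℤ) → sumFrom f a m ≤ 0ℤ
sumFrom-nonpos f a m f≤0 = subst (sumFrom f a m ≤_) (sumFrom-zero a m) (sumFrom-mono-≤ a m f≤0)

sumFrom-monoʳ-≤ : ∀ f a {m n} → (∀ i → m ℕ.≤ i → 0ℤ ≤ f (a + + i)) → m ℕ.≤ n →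
                  sumFrom f a m ≤ sumFrom f a n
sumFrom-monoʳ-≤ f a {m} {n} 0≤f m≤n = begin
  sumFrom f a m                                 ≡⟨ +-identityʳ _ ⟨
  sumFrom f a m + 0ℤ                            ≤⟨ +-monoʳ-≤ (sumFrom f a m) 0≤rest ⟩
  sumFrom f a m + sumFrom f (a + + m) (n ℕ.∸ m) ≡⟨ sumFrom-++ f a m (n ℕ.∸ m) ⟨
  sumFrom f a (m ℕ.+ (n ℕ.∸ m))                 ≡⟨ cong (sumFrom f a) (ℕ.m+[n∸m]≡n m≤n) ⟩
  sumFrom f a n                                 ∎
  where
  open ≤-Reasoning
  0≤rest : 0ℤ ≤ sumFrom f (a + + m) (n ℕ.∸ m)
  0≤rest = sumFrom-nonneg f (a + + m) (n ℕ.∸ m) λ i _ →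
    subst (λ b → 0ℤ ≤ f b) (sym (+-assoc a (+ m) (+ i))) (0≤f (m ℕ.+ i) (ℕ.m≤m+n m i))

sumRange-empty : ∀ f {a b} → b < a → sumRange f a b ≡ 0ℤ
sumRange-empty f {a} {b} b<a with b <? a
... | yes _   = refl
... | no  b≮a = contradiction b<a b≮a

sumRange-sumFrom : ∀ f a n → sumRange f a (a + + n) ≡ sumFrom f a (suc n)
sumRange-sumFrom f a n with a + + n <? a
... | yes a+n<a = contradiction a+n<a (≤⇒≯ (i≤i+j a (+ n)))
... | no  _     = cong (λ l → sumFrom f a ∣ l ∣) (i+j-i+1≡1+j a (+ n))
  where
  i+j-i+1≡1+j : ∀ i j → i + j - i + 1ℤ ≡ 1ℤ + j
  i+j-i+1≡1+j = solve-∀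

sumRange-neg-start : ∀ f k n → sumRange f -[1+ k ] (+ n) ≡ sumFrom f -[1+ k ] (suc (suc k ℕ.+ n))
sumRange-neg-start f k n = begin
  sumRange f -[1+ k ] (+ n)
    ≡⟨ cong (sumRange f -[1+ k ]) (-[1+m]+[1+m+n]≡n k n) ⟨
  sumRange f -[1+ k ] (-[1+ k ] + + (suc k ℕ.+ n))
    ≡⟨ sumRange-sumFrom f -[1+ k ] (suc k ℕ.+ n) ⟩
  sumFrom f -[1+ k ] (suc (suc k ℕ.+ n))
    ∎
  where open ≡-Reasoning

module _ {f : ℤ → ℤ} (0≤Sg*f : ∀ n → 0ℤ ≤ Sg n * f n) where

  f-nonneg : ∀ {n} → 0ℤ ≤ n → 0ℤ ≤ f n
  f-nonneg {n} 0≤n = subst (0ℤ ≤_) (Sg*-nonneg 0≤n (f n)) (0≤Sg*f n)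

  f-nonpos : ∀ {n} → n < 0ℤ → f n ≤ 0ℤ
  f-nonpos {n} n<0 = neg-cancel-≤ (subst (0ℤ ≤_) (Sg*-neg n<0 (f n)) (0≤Sg*f n))

  sumFrom-nonneg-start : ∀ i m → 0ℤ ≤ sumFrom f (+ i) m
  sumFrom-nonneg-start i m = sumFrom-nonneg f (+ i) m λ _ _ → f-nonneg (+≤+ ℕ.z≤n)

  sumFrom-neg-prefix : ∀ k {m} → m ℕ.≤ suc k → sumFrom f -[1+ k ] m ≤ 0ℤ
  sumFrom-neg-prefix k m≤1+k = sumFrom-nonpos f -[1+ k ] _ λ i i<m →
    f-nonpos (m<n⇒m⊖n<0 (ℕ.<-≤-trans i<m m≤1+k))

  sumFrom-neg-monoʳ-≤ : ∀ k {m n} → suc k ℕ.≤ m → m ℕ.≤ n →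
                        sumFrom f -[1+ k ] m ≤ sumFrom f -[1+ k ] n
  sumFrom-neg-monoʳ-≤ k 1+k≤m = sumFrom-monoʳ-≤ f -[1+ k ] λ i m≤i →
    f-nonneg (n≤m⇒0≤m⊖n (ℕ.≤-trans 1+k≤m m≤i))

  module _ (left  : ∀ k → sumRange f (- (+ suc k)) (+ k) ≤ 0ℤ)
           (right : ∀ k → 0ℤ ≤ sumRange f (- (+ suc k)) (+ suc k)) where

    -- The windows [-(k+1), k] and [-(k+1), k+1] have 2k + 2 and 2k + 3 terms.
    sumFrom-neg-short : ∀ k {m} → m ℕ.≤ suc (suc k ℕ.+ k) → sumFrom f -[1+ k ] m ≤ 0ℤ
    sumFrom-neg-short k {m} m≤2+2k with m ℕ.≤? suc k
    ... | yes m≤1+k = sumFrom-neg-prefix k m≤1+k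
    ... | no  m≰1+k = ≤-trans (sumFrom-neg-monoʳ-≤ k (ℕ.<⇒≤ (ℕ.≰⇒> m≰1+k)) m≤2+2k)
                              (subst (_≤ 0ℤ) (sumRange-neg-start f k k) (left k))

    sumFrom-neg-long : ∀ k {m} → suc (suc k ℕ.+ k) ℕ.< m → 0ℤ ≤ sumFrom f -[1+ k ] m
    sumFrom-neg-long k {m} 2+2k<m =
      ≤-trans (subst (0ℤ ≤_) (sumRange-neg-start f k (suc k)) (right k))
              (sumFrom-neg-monoʳ-≤ k (ℕ.≤-trans (ℕ.m≤m+n (suc k) (suc k)) (ℕ.n≤1+n _)) 3+2k≤m)
      where
      3+2k≤m : suc (suc k ℕ.+ suc k) ℕ.≤ m
      3+2k≤m = subst (ℕ._≤ m) (cong (λ l → suc (suc l)) (sym (ℕ.+-suc k k))) 2+2k<m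

    0≤Sg*sumRange : ∀ a n → 0ℤ ≤ Sg (a + (a + + n)) * sumRange f a (a + + n)
    0≤Sg*sumRange (+ i) n rewrite sumRange-sumFrom f (+ i) n =
      0≤Sg*-nonneg {s = + i + (+ i + + n)} (+≤+ ℕ.z≤n) (sumFrom-nonneg-start i (suc n))
    0≤Sg*sumRange -[1+ k ] n
      rewrite sumRange-sumFrom f -[1+ k ] n | sym (+-assoc -[1+ k ] -[1+ k ] (+ n))
      with n ℕ.<? suc (suc k ℕ.+ k)   -- a + b has become n ⊖ (2k + 2)
    ... | yes n<2+2k = 0≤Sg*-neg (m<n⇒m⊖n<0 n<2+2k) (sumFrom-neg-short k n<2+2k)
    ... | no  n≮2+2k = 0≤Sg*-nonneg (n≤m⇒0≤m⊖n 2+2k≤n) (sumFrom-neg-long k (ℕ.s≤s 2+2k≤n))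
      where
      2+2k≤n : suc (suc k ℕ.+ k) ℕ.≤ n
      2+2k≤n = ℕ.≮⇒≥ n≮2+2k

lemma2p1 : (f : ℤ → ℤ) →
    (∀ n → 0ℤ ≤ Sg n * f n) →
    (∀ (k : ℕ) → sumRange f (- (+ suc k)) (+ k) ≤ 0ℤ) →
    (∀ (k : ℕ) → 0ℤ ≤ sumRange f (- (+ suc k)) (+ suc k)) →
    ∀ a b → 0ℤ ≤ Sg (a + b) * sumRange f a b
lemma2p1 f 0≤Sg*f left right a b with <⊎≡+ a b
... | inj₁ b<a rewrite sumRange-empty f b<a | *-zeroʳ (Sg (a + b)) = ≤-refl
... | inj₂ (n , refl) = 0≤Sg*sumRange 0≤Sg*f left right a n
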